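{- Let $M$ be a simple rank-$3$ matroid on nine elements whose ground set is the union of three long lines that pass through a common point. Then either $M$ has a $U_{2,5}$-minor, or $M \cong R_9$.
   Context: A point of a matroid is a rank-one flat; a line is a rank-two flat; a line is long if it contains at least three points. $R_9$ (the ternary Reid geometry) is the simple rank-$3$ matroid consisting of long lines $L_1, L_2, L_3$ with a common intersection point $x$ such that $|L_1| = |L_2| = 4$, $|L_3| = 3$, and both elements of $L_3 - \{x\}$ lie on four long lines. -}

module Defs where

open import Data.Nat using (ℕ; _≤_; _<_; _∸_; _⊓_; _+_)
open import Data.Bool using (if_then_else_)
open import Data.Fin using (Fin)
open import Data.Fin.Subset using (Subset; ⁅_⁆; _∈_; _∉_; _⊆_; _∩_; _∪_; ⋃; ∣_∣; ⊥; ⊤)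
open import Data.List using (List; map; allFin)
open import Data.Vec using (lookup)
open import Data.Product using (Σ; _×_; ∃; ∃-syntax)
open import Data.Sum using (_⊎_)
open import Relation.Binary.PropositionalEquality using (_≡_; _≢_)
open import Function.Definitions using (Injective)

record Matroid (n : ℕ) : Set where
  field
    rank       : Subset n → ℕ
    rank-≤card : ∀ X → rank X ≤ ∣ X ∣
    rank-mono  : ∀ X Y → X ⊆ Y → rank X ≤ rank Y
    rank-submod : ∀ X Y → rank (X ∪ Y) + rank (X ∩ Y) ≤ rank X + rank Y
open Matroid public

module _ {n : ℕ} (M : Matroid n) where

  Simple : Set
  Simple = ∀ X → ∣ X ∣ ≤ 2 → rank M X ≡ ∣ X ∣

  Flat : Subset n → Set
  Flat X = ∀ e → e ∉ X → rank M X < rank M (⁅ e ⁆ ∪ X)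

  Line : Subset n → Set
  Line L = Flat L × rank M L ≡ 2

  -- a line is long if it contains at least three points (rank-one flats);
  -- equivalently it contains three elements a, b, c that are non-loops and
  -- pairwise non-parallel (so they span three distinct points).
  LongLine : Subset n → Set
  LongLine L = Line L × ∃[ a ] ∃[ b ] ∃[ c ]
    (a ∈ L × b ∈ L × c ∈ L
     × rank M ⁅ a ⁆ ≡ 1 × rank M ⁅ b ⁆ ≡ 1 × rank M ⁅ c ⁆ ≡ 1
     × rank M (⁅ a ⁆ ∪ ⁅ b ⁆) ≡ 2 × rank M (⁅ a ⁆ ∪ ⁅ c ⁆) ≡ 2
     × rank M (⁅ b ⁆ ∪ ⁅ c ⁆) ≡ 2)

  OnFourLongLines : Fin n → Set
  OnFourLongLines e = ∃[ A ] ∃[ B ] ∃[ C ] ∃[ D ]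
    (LongLine A × LongLine B × LongLine C × LongLine D
     × e ∈ A × e ∈ B × e ∈ C × e ∈ D
     × A ≢ B × A ≢ C × A ≢ D × B ≢ C × B ≢ D × C ≢ D)



image : {k m : ℕ} → (Fin k → Fin m) → Subset k → Subset m
image f X = ⋃ (map (λ i → if lookup X i then ⁅ f i ⁆ else ⊥) (allFin _))

uniformRank : (r n : ℕ) → Subset n → ℕ
uniformRank r n X = ∣ X ∣ ⊓ r

-- The matroid N on Fin k with rank function rN is isomorphic to a minor of M:
-- there is a set C (contracted) and an injection f : Fin k → E(M) − C such
-- that, after deleting everything outside C ∪ im f, the contraction M / C
-- (rank r_{M/C}(Y) = r_M(Y ∪ C) − r_M(C)) is isomorphic via f to N.
HasMinor : {k m : ℕ} → Matroid m → (Subset k → ℕ) → Set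
HasMinor {k} {m} M rN =
  ∃[ C ] ∃[ f ] (Injective _≡_ _≡_ f × (∀ i → f i ∉ C)
    × (∀ (X : Subset k) → rank M (image f X ∪ C) ∸ rank M C ≡ rN X))

HasU25Minor : {m : ℕ} → Matroid m → Set
HasU25Minor M = HasMinor M (uniformRank 2 5)

UnionOfThreeConcurrentLongLines : {n : ℕ} → Matroid n → Set
UnionOfThreeConcurrentLongLines {n} M =
  ∃[ L₁ ] ∃[ L₂ ] ∃[ L₃ ] ∃[ x ]
    (LongLine M L₁ × LongLine M L₂ × LongLine M L₃
     × L₁ ≢ L₂ × L₁ ≢ L₃ × L₂ ≢ L₃
     × x ∈ L₁ × x ∈ L₂ × x ∈ L₃
     × (∀ (e : Fin n) → e ∈ L₁ ⊎ e ∈ L₂ ⊎ e ∈ L₃))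

-- M is (isomorphic to) the ternary Reid geometry R₉, following the paper's
-- definition: M is a simple rank-3 matroid whose ground set is the union of long
-- lines L₁, L₂, L₃ with a common point x, |L₁| = |L₂| = 4, |L₃| = 3, and both
-- elements of L₃ − {x} lie on four (distinct) long lines.
IsR₉ : {n : ℕ} → Matroid n → Set
IsR₉ {n} M =
  Simple M × rank M ⊤ ≡ 3 ×
  ∃[ L₁ ] ∃[ L₂ ] ∃[ L₃ ] ∃[ x ]
    (LongLine M L₁ × LongLine M L₂ × LongLine M L₃
     × L₁ ≢ L₂ × L₁ ≢ L₃ × L₂ ≢ L₃
     × x ∈ L₁ × x ∈ L₂ × x ∈ L₃
     × (∀ (e : Fin n) → e ∈ L₁ ⊎ e ∈ L₂ ⊎ e ∈ L₃)
     × ∣ L₁ ∣ ≡ 4 × ∣ L₂ ∣ ≡ 4 × ∣ L₃ ∣ ≡ 3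
     × (∀ (e : Fin n) → e ∈ L₃ → e ≢ x → OnFourLongLines M e))

module Submission where

-- Two distinct lines through x meet only in x, so inclusion–exclusion gives
-- |L₁| + |L₂| + |L₃| = 9 + 2.  A line with five points is a U₂,₅-restriction and
-- a long line has at least three points, so the sizes are 4, 4, 3 in some order;
-- say L₃ = {x, c₁, c₂}.  Fix c = cᵢ.  If some b ∈ L₂ − x is collinear with c and
-- no point of L₁ − x, then in M / c the four points of L₁ together with b are
-- pairwise non-collinear with c, which is a U₂,₅-minor.  Otherwise every b ∈ L₂ − x
-- spans with c and some a ∈ L₁ − x a long line {c, a, b}; these three lines and L₃
-- are four long lines through c, and M is R₉.

open import Defs
open import Data.Nat using (ℕ; suc; _+_; _≤_; _<_; _∸_; _⊓_; s≤s; z≤n)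
import Data.Nat.Properties as ℕ
open import Data.Bool using (true; false; if_then_else_)
open import Data.Empty using (⊥-elim) renaming (⊥ to Empty)
open import Data.Fin using (Fin; zero; suc)
open import Data.Fin.Properties using (any?; suc-injective; _≟_)
open import Data.Fin.Subset using (Subset; ⁅_⁆; _∈_; _∉_; _⊆_; _∪_; _∩_; ⋃; ∣_∣; ⊥; ⊤; inside; outside)
open import Data.Fin.Subset.Properties
  using ( x∈p∪q⁺; x∈p∪q⁻; x∈p∩q⁺; x∈p∩q⁻; x∈⁅x⁆; x∈⁅y⁆⇒x≡y; ∉⊥; ⊥⊆; ∈⊤; ⊆-antisym; _∈?_
        ; ∣⊥∣≡0; ∣⊤∣≡n; ∣⁅x⁆∣≡1; p⊆q⇒∣p∣≤∣q∣; ∪-idem; ∪-assoc; ∪-identityˡ; ∪-identityʳ)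
open import Data.List using (List; allFin)
import Data.List as List
import Data.List.Relation.Unary.Any as ListAny
open import Data.List.Relation.Unary.Any.Properties using (map⁺; map⁻)
open import Data.List.Membership.Propositional using (lose)
open import Data.List.Membership.Propositional.Properties using (∈-allFin)
open import Data.Vec using (Vec; []; _∷_; lookup)
import Data.Vec.Base as Vec
open import Data.Vec.Properties using ([]=⇒lookup; lookup⇒[]=)
open import Data.Vec.Relation.Unary.Any using (here; there)
open import Data.Vec.Relation.Unary.All using (All; []; _∷_)
import Data.Vec.Relation.Unary.All as All
open import Data.Vec.Relation.Unary.All.Properties using (lookup⁺)
open import Data.Vec.Relation.Unary.AllPairs using ([]; _∷_)
open import Data.Vec.Relation.Unary.Unique.Propositional using (Unique)
open import Data.Vec.Relation.Unary.Unique.Propositional.Properties using (lookup-injective)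
open import Data.Vec.Membership.Propositional using () renaming (_∈_ to _∈ᵥ_)
open import Data.Vec.Membership.Propositional.Properties using (∈-lookup)
open import Data.Product using (∃; ∃₂; _×_; _,_; proj₁; proj₂)
open import Data.Sum using (_⊎_; inj₁; inj₂; [_,_]; swap; map₂; assocʳ)
open import Function.Definitions using (Injective)
open import Relation.Nullary using (¬_; Dec; yes; no; ¬?; contradiction)
open import Relation.Nullary.Decidable using (_×-dec_; decidable-stable)
open import Relation.Binary.PropositionalEquality
  using (_≡_; _≢_; refl; sym; trans; cong; cong₂; subst; ≢-sym; module ≡-Reasoning)
open ≡-Reasoning

private variable
  n k : ℕ

∣p∪q∣+∣p∩q∣≡∣p∣+∣q∣ : (p q : Subset n) → ∣ p ∪ q ∣ + ∣ p ∩ q ∣ ≡ ∣ p ∣ + ∣ q ∣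
∣p∪q∣+∣p∩q∣≡∣p∣+∣q∣ []            []            = refl
∣p∪q∣+∣p∩q∣≡∣p∣+∣q∣ (outside ∷ p) (outside ∷ q) = ∣p∪q∣+∣p∩q∣≡∣p∣+∣q∣ p q
∣p∪q∣+∣p∩q∣≡∣p∣+∣q∣ (inside ∷ p)  (outside ∷ q) = cong suc (∣p∪q∣+∣p∩q∣≡∣p∣+∣q∣ p q)
∣p∪q∣+∣p∩q∣≡∣p∣+∣q∣ (outside ∷ p) (inside ∷ q)  =
  trans (cong suc (∣p∪q∣+∣p∩q∣≡∣p∣+∣q∣ p q)) (sym (ℕ.+-suc ∣ p ∣ ∣ q ∣))
∣p∪q∣+∣p∩q∣≡∣p∣+∣q∣ (inside ∷ p)  (inside ∷ q)  =
  cong suc (trans (ℕ.+-suc ∣ p ∪ q ∣ ∣ p ∩ q ∣)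
                  (trans (cong suc (∣p∪q∣+∣p∩q∣≡∣p∣+∣q∣ p q)) (sym (ℕ.+-suc ∣ p ∣ ∣ q ∣))))

∣p∪q∣+1≡∣p∣+∣q∣ : {p q : Subset n} {x : Fin n} → p ∩ q ≡ ⁅ x ⁆ → ∣ p ∪ q ∣ + 1 ≡ ∣ p ∣ + ∣ q ∣
∣p∪q∣+1≡∣p∣+∣q∣ {p = p} {q} {x} p∩q≡x =
  trans (cong (∣ p ∪ q ∣ +_) (trans (sym (∣⁅x⁆∣≡1 x)) (cong ∣_∣ (sym p∩q≡x)))) (∣p∪q∣+∣p∩q∣≡∣p∣+∣q∣ p q)

∣⁅x⁆∪p∣≡1+∣p∣ : ∀ {n} {x : Fin n} (p : Subset n) → x ∉ p → ∣ ⁅ x ⁆ ∪ p ∣ ≡ suc ∣ p ∣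
∣⁅x⁆∪p∣≡1+∣p∣ {n} {x} p x∉p = begin
  ∣ ⁅ x ⁆ ∪ p ∣                   ≡⟨ sym (ℕ.+-identityʳ _) ⟩
  ∣ ⁅ x ⁆ ∪ p ∣ + 0               ≡⟨ cong (∣ ⁅ x ⁆ ∪ p ∣ +_) (sym (trans (cong ∣_∣ disjoint) (∣⊥∣≡0 n))) ⟩
  ∣ ⁅ x ⁆ ∪ p ∣ + ∣ ⁅ x ⁆ ∩ p ∣   ≡⟨ ∣p∪q∣+∣p∩q∣≡∣p∣+∣q∣ ⁅ x ⁆ p ⟩
  ∣ ⁅ x ⁆ ∣ + ∣ p ∣               ≡⟨ cong (_+ ∣ p ∣) (∣⁅x⁆∣≡1 x) ⟩
  suc ∣ p ∣                       ∎
  where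
  disjoint : ⁅ x ⁆ ∩ p ≡ ⊥
  disjoint = ⊆-antisym (λ e∈ → let e∈x , e∈p = x∈p∩q⁻ _ _ e∈
                                in contradiction (subst (_∈ p) (x∈⁅y⁆⇒x≡y x e∈x) e∈p) x∉p) ⊥⊆

∣⁅x⁆∪⁅y⁆∣≡2 : {x y : Fin n} → x ≢ y → ∣ ⁅ x ⁆ ∪ ⁅ y ⁆ ∣ ≡ 2
∣⁅x⁆∪⁅y⁆∣≡2 {y = y} x≢y =
  trans (∣⁅x⁆∪p∣≡1+∣p∣ ⁅ y ⁆ (λ x∈y → x≢y (x∈⁅y⁆⇒x≡y y x∈y))) (cong suc (∣⁅x⁆∣≡1 y))

subset-trichotomy : (X : Subset n) →
  X ≡ ⊥ ⊎ (∃ λ i → X ≡ ⁅ i ⁆) ⊎ (∃₂ λ i j → i ≢ j × i ∈ X × j ∈ X)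
subset-trichotomy [] = inj₁ refl
subset-trichotomy (outside ∷ X) with subset-trichotomy X
... | inj₁ refl                              = inj₁ refl
... | inj₂ (inj₁ (i , refl))                 = inj₂ (inj₁ (suc i , refl))
... | inj₂ (inj₂ (i , j , i≢j , i∈X , j∈X)) =
  inj₂ (inj₂ (suc i , suc j , (λ eq → i≢j (suc-injective eq)) , Vec.there i∈X , Vec.there j∈X))
subset-trichotomy (inside ∷ X) with subset-trichotomy X
... | inj₁ refl                              = inj₂ (inj₁ (zero , refl))
... | inj₂ (inj₁ (i , refl))                 = inj₂ (inj₂ (zero , suc i , (λ ()) , Vec.here , Vec.there (x∈⁅x⁆ i)))
... | inj₂ (inj₂ (i , j , i≢j , i∈X , j∈X)) =
  inj₂ (inj₂ (suc i , suc j , (λ eq → i≢j (suc-injective eq)) , Vec.there i∈X , Vec.there j∈X))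

⊆⊎∉ : (X Y : Subset n) → X ⊆ Y ⊎ ∃ λ e → e ∈ X × e ∉ Y
⊆⊎∉ X Y with any? (λ e → (e ∈? X) ×-dec ¬? (e ∈? Y))
... | yes witness = inj₂ witness
... | no  none    = inj₁ λ {e} e∈X → decidable-stable (e ∈? Y) (λ e∉Y → none (e , e∈X , e∉Y))

x∈p⇒⁅x⁆⊆p : {x : Fin n} {p : Subset n} → x ∈ p → ⁅ x ⁆ ⊆ p
x∈p⇒⁅x⁆⊆p {x = x} x∈p e∈ = subst (_∈ _) (sym (x∈⁅y⁆⇒x≡y x e∈)) x∈p

∪-⊆ : {p q r : Subset n} → p ⊆ r → q ⊆ r → p ∪ q ⊆ r
∪-⊆ {p = p} {q} p⊆r q⊆r e∈ = [ p⊆r , q⊆r ] (x∈p∪q⁻ p q e∈)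

pair-⊆ : {x y : Fin n} {X : Subset n} → x ∈ X → y ∈ X → ⁅ x ⁆ ∪ ⁅ y ⁆ ⊆ X
pair-⊆ x∈X y∈X = ∪-⊆ (x∈p⇒⁅x⁆⊆p x∈X) (x∈p⇒⁅x⁆⊆p y∈X)

∈-⋃⁺ : {e : Fin n} {ps : List (Subset n)} → ListAny.Any (e ∈_) ps → e ∈ ⋃ ps
∈-⋃⁺ (ListAny.here e∈p)   = x∈p∪q⁺ (inj₁ e∈p)
∈-⋃⁺ (ListAny.there e∈ps) = x∈p∪q⁺ (inj₂ (∈-⋃⁺ e∈ps))

∈-⋃⁻ : {e : Fin n} (ps : List (Subset n)) → e ∈ ⋃ ps → ListAny.Any (e ∈_) ps
∈-⋃⁻ List.[]       e∈ = contradiction e∈ ∉⊥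
∈-⋃⁻ (p List.∷ ps) e∈ with x∈p∪q⁻ p (⋃ ps) e∈
... | inj₁ e∈p  = ListAny.here e∈p
... | inj₂ e∈ps = ListAny.there (∈-⋃⁻ ps e∈ps)

module _ {m : ℕ} (f : Fin k → Fin m) {X : Subset k} where

  ∈-image⁺ : {i : Fin k} → i ∈ X → f i ∈ image f X
  ∈-image⁺ {i} i∈X = ∈-⋃⁺ (map⁺ (lose (∈-allFin i) fi∈))
    where
    fi∈ : f i ∈ (if lookup X i then ⁅ f i ⁆ else ⊥)
    fi∈ rewrite []=⇒lookup i∈X = x∈⁅x⁆ (f i)

  ∈-image⁻ : {e : Fin m} → e ∈ image f X → ∃ λ i → i ∈ X × e ≡ f i
  ∈-image⁻ e∈ =
    let i , e∈piece = ListAny.satisfied (map⁻ {xs = allFin k} (∈-⋃⁻ (List.map piece (allFin k)) e∈))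
    in i , member (lookup X i) refl e∈piece
    where
    piece : Fin k → Subset m
    piece i = if lookup X i then ⁅ f i ⁆ else ⊥

    member : ∀ {e i} b → lookup X i ≡ b → e ∈ (if b then ⁅ f i ⁆ else ⊥) → i ∈ X × e ≡ f i
    member {i = i} true  eq e∈ = lookup⇒[]= i X eq , x∈⁅y⁆⇒x≡y (f i) e∈
    member         false _  e∈ = contradiction e∈ ∉⊥

image-⊥ : ∀ {m} (f : Fin k → Fin m) → image f ⊥ ≡ ⊥
image-⊥ f = ⊆-antisym (λ e∈ → let _ , i∈⊥ , _ = ∈-image⁻ f e∈ in contradiction i∈⊥ ∉⊥) ⊥⊆

image-⁅⁆ : ∀ {m} (f : Fin k → Fin m) (i : Fin k) → image f ⁅ i ⁆ ≡ ⁅ f i ⁆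
image-⁅⁆ f i = ⊆-antisym
  (λ e∈ → let j , j∈ , e≡fj = ∈-image⁻ f e∈ in
          subst (_∈ ⁅ f i ⁆) (sym (trans e≡fj (cong f (x∈⁅y⁆⇒x≡y i j∈)))) (x∈⁅x⁆ (f i)))
  (λ e∈ → subst (_∈ image f ⁅ i ⁆) (sym (x∈⁅y⁆⇒x≡y (f i) e∈)) (∈-image⁺ f (x∈⁅x⁆ i)))

image-⊆ : ∀ {m} (f : Fin k → Fin m) {X : Subset k} {S : Subset m} → (∀ i → f i ∈ S) → image f X ⊆ S
image-⊆ f {X} f∈S e∈ = let i , _ , e≡fi = ∈-image⁻ f {X} e∈ in subst (_∈ _) (sym e≡fi) (f∈S i)

fromVec : Vec (Fin n) k → Subset n
fromVec []       = ⊥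
fromVec (a ∷ as) = ⁅ a ⁆ ∪ fromVec as

∈-fromVec⁺ : {e : Fin n} {vs : Vec (Fin n) k} → e ∈ᵥ vs → e ∈ fromVec vs
∈-fromVec⁺ (here refl) = x∈p∪q⁺ (inj₁ (x∈⁅x⁆ _))
∈-fromVec⁺ (there e∈)  = x∈p∪q⁺ (inj₂ (∈-fromVec⁺ e∈))

∈-fromVec⁻ : {e : Fin n} (vs : Vec (Fin n) k) → e ∈ fromVec vs → e ∈ᵥ vs
∈-fromVec⁻ []       e∈ = contradiction e∈ ∉⊥
∈-fromVec⁻ (a ∷ as) e∈ with x∈p∪q⁻ ⁅ a ⁆ (fromVec as) e∈
... | inj₁ e∈a  = here (x∈⁅y⁆⇒x≡y a e∈a)
... | inj₂ e∈as = there (∈-fromVec⁻ as e∈as)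

∈-triangle : (a b c : Fin n) →
  a ∈ fromVec (a ∷ b ∷ c ∷ []) × b ∈ fromVec (a ∷ b ∷ c ∷ []) × c ∈ fromVec (a ∷ b ∷ c ∷ [])
∈-triangle a b c = member (here refl) , member (there (here refl)) , member (there (there (here refl)))
  where
  member : {e : Fin _} → e ∈ᵥ (a ∷ b ∷ c ∷ []) → e ∈ fromVec (a ∷ b ∷ c ∷ [])
  member = ∈-fromVec⁺

fromVec-⊆ : {vs : Vec (Fin n) k} {X : Subset n} → All (_∈ X) vs → fromVec vs ⊆ X
fromVec-⊆ vs⊆X e∈ = All.lookup vs⊆X (∈-fromVec⁻ _ e∈)

≡fromVec⇒All∈ : {L : Subset n} {vs : Vec (Fin n) k} → L ≡ fromVec vs → All (_∈ L) vs
≡fromVec⇒All∈ {vs = []}     refl = []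
≡fromVec⇒All∈ {vs = v ∷ vs} refl =
  x∈p∪q⁺ (inj₁ (x∈⁅x⁆ v)) ∷ All.map (λ e∈ → x∈p∪q⁺ (inj₂ e∈)) (≡fromVec⇒All∈ {vs = vs} refl)

All≢⇒∉fromVec : {a : Fin n} {vs : Vec (Fin n) k} → All (a ≢_) vs → a ∉ fromVec vs
All≢⇒∉fromVec a≢vs a∈ = All.lookup a≢vs (∈-fromVec⁻ _ a∈) refl

∉fromVec⇒All≢ : {a : Fin n} (vs : Vec (Fin n) k) → a ∉ fromVec vs → All (a ≢_) vs
∉fromVec⇒All≢ []       _  = []
∉fromVec⇒All≢ (v ∷ vs) a∉ =
  (λ { refl → a∉ (x∈p∪q⁺ (inj₁ (x∈⁅x⁆ v))) }) ∷ ∉fromVec⇒All≢ vs (λ a∈ → a∉ (x∈p∪q⁺ {p = ⁅ v ⁆} (inj₂ a∈)))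

∣fromVec∣ : {vs : Vec (Fin n) k} → Unique vs → ∣ fromVec vs ∣ ≡ k
∣fromVec∣ {n} []        = ∣⊥∣≡0 n
∣fromVec∣ (a≢ ∷ unique) = trans (∣⁅x⁆∪p∣≡1+∣p∣ _ (All≢⇒∉fromVec a≢)) (cong suc (∣fromVec∣ unique))

≡fromVec⊎extend : (L : Subset n) {vs : Vec (Fin n) k} → Unique vs → All (_∈ L) vs →
  L ≡ fromVec vs ⊎ ∃ λ w → Unique (w ∷ vs) × All (_∈ L) (w ∷ vs)
≡fromVec⊎extend L {vs} unique vs⊆L with ⊆⊎∉ L (fromVec vs)
... | inj₁ L⊆vs           = inj₁ (⊆-antisym L⊆vs (fromVec-⊆ vs⊆L))
... | inj₂ (w , w∈L , w∉) = inj₂ (w , ∉fromVec⇒All≢ vs w∉ ∷ unique , w∈L ∷ vs⊆L)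

data ThreeOrFourPoints (L : Subset n) (x : Fin n) : Set where
  three : {u v : Fin n} → Unique (u ∷ v ∷ x ∷ []) → L ≡ fromVec (u ∷ v ∷ x ∷ []) → ThreeOrFourPoints L x
  four  : {u v w : Fin n} → Unique (u ∷ v ∷ w ∷ x ∷ []) → L ≡ fromVec (u ∷ v ∷ w ∷ x ∷ []) →
          ThreeOrFourPoints L x

pointCount : {L : Subset n} {x : Fin n} → ThreeOrFourPoints L x → ℕ
pointCount (three _ _) = 3
pointCount (four _ _)  = 4

∣L∣≡pointCount : {L : Subset n} {x : Fin n} (s : ThreeOrFourPoints L x) → ∣ L ∣ ≡ pointCount s
∣L∣≡pointCount (three unique refl) = ∣fromVec∣ unique
∣L∣≡pointCount (four unique refl)  = ∣fromVec∣ unique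

∀⊎⇒⊎∀ : {A : Set} {P : Fin n → Set} → (∀ i → A ⊎ P i) → A ⊎ (∀ i → P i)
∀⊎⇒⊎∀ {0}     _ = inj₂ λ ()
∀⊎⇒⊎∀ {suc n} h with h zero | ∀⊎⇒⊎∀ (λ i → h (suc i))
... | inj₁ a  | _       = inj₁ a
... | inj₂ _  | inj₁ a  = inj₁ a
... | inj₂ p₀ | inj₂ pₛ = inj₂ λ { zero → p₀ ; (suc i) → pₛ i }

module _ {n : ℕ} (M : Matroid n) where

  rank-⊥ : rank M ⊥ ≡ 0
  rank-⊥ = ℕ.n≤0⇒n≡0 (subst (rank M ⊥ ≤_) (∣⊥∣≡0 n) (rank-≤card M ⊥))

  rank-pair≡2⇒≢ : {a b : Fin n} → rank M (⁅ a ⁆ ∪ ⁅ b ⁆) ≡ 2 → a ≢ b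
  rank-pair≡2⇒≢ {a} rank≡2 refl = ℕ.<⇒≱ (s≤s (s≤s z≤n))
    (subst (_≤ 1) rank≡2 (subst (λ X → rank M X ≤ 1) (sym (∪-idem ⁅ a ⁆))
      (subst (rank M ⁅ a ⁆ ≤_) (∣⁅x⁆∣≡1 a) (rank-≤card M ⁅ a ⁆))))

  Collinear : Fin n → Fin n → Fin n → Set
  Collinear a b c = rank M (fromVec (a ∷ b ∷ c ∷ [])) ≤ 2

  Collinear-swap : {p a b : Fin n} → Collinear p a b → Collinear p b a
  Collinear-swap {p} {a} {b} = let p∈ , a∈ , b∈ = ∈-triangle p a b in
    ℕ.≤-trans (rank-mono M _ _ (fromVec-⊆ (p∈ ∷ b∈ ∷ a∈ ∷ [])))

  record Concurrent (L₁ L₂ L₃ : Subset n) (x : Fin n) : Set where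
    constructor concurrent
    field
      long₁ : LongLine M L₁
      long₂ : LongLine M L₂
      long₃ : LongLine M L₃
      L₁≢L₂ : L₁ ≢ L₂
      L₁≢L₃ : L₁ ≢ L₃
      L₂≢L₃ : L₂ ≢ L₃
      x∈L₁  : x ∈ L₁
      x∈L₂  : x ∈ L₂
      x∈L₃  : x ∈ L₃
      cover : ∀ e → e ∈ L₁ ⊎ e ∈ L₂ ⊎ e ∈ L₃

  Concurrent-rotate : {L₁ L₂ L₃ : Subset n} {x : Fin n} → Concurrent L₁ L₂ L₃ x → Concurrent L₂ L₃ L₁ x
  Concurrent-rotate conc = record
    { long₁ = long₂ ; long₂ = long₃ ; long₃ = long₁
    ; L₁≢L₂ = L₂≢L₃ ; L₁≢L₃ = ≢-sym L₁≢L₂ ; L₂≢L₃ = ≢-sym L₁≢L₃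
    ; x∈L₁ = x∈L₂ ; x∈L₂ = x∈L₃ ; x∈L₃ = x∈L₁
    ; cover = λ e → assocʳ (swap (cover e))
    } where open Concurrent conc

  Concurrent-swap : {L₁ L₂ L₃ : Subset n} {x : Fin n} → Concurrent L₁ L₂ L₃ x → Concurrent L₁ L₃ L₂ x
  Concurrent-swap conc = record
    { long₁ = long₁ ; long₂ = long₃ ; long₃ = long₂
    ; L₁≢L₂ = L₁≢L₃ ; L₁≢L₃ = L₁≢L₂ ; L₂≢L₃ = ≢-sym L₂≢L₃
    ; x∈L₁ = x∈L₁ ; x∈L₂ = x∈L₃ ; x∈L₃ = x∈L₂
    ; cover = λ e → map₂ swap (cover e)
    } where open Concurrent conc

U₂-minor : ∀ {n} (M : Matroid n) (C S : Subset n) (f : Fin k → Fin n)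
  → (∀ i → rank M (⁅ f i ⁆ ∪ C) ≡ suc (rank M C))
  → (∀ i j → i ≢ j → 2 + rank M C ≤ rank M (⁅ f i ⁆ ∪ ⁅ f j ⁆ ∪ C))
  → (∀ i → f i ∈ S) → C ⊆ S → rank M S ≤ 2 + rank M C
  → HasMinor M (uniformRank 2 k)
U₂-minor {k} M C S f point line f∈S C⊆S rankS = C , f , injective , avoids , contracted
  where
  ρ : Subset _ → ℕ
  ρ = rank M

  injective : Injective _≡_ _≡_ f
  injective {i} {j} fi≡fj with i ≟ j
  ... | yes i≡j = i≡j
  ... | no  i≢j = contradiction (subst (2 + ρ C ≤_) collapse (line i j i≢j)) (ℕ.n≮n (suc (ρ C)))
    where
    collapse : ρ (⁅ f i ⁆ ∪ ⁅ f j ⁆ ∪ C) ≡ suc (ρ C)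
    collapse = begin
      ρ (⁅ f i ⁆ ∪ ⁅ f j ⁆ ∪ C)   ≡⟨ cong (λ y → ρ (⁅ f i ⁆ ∪ ⁅ y ⁆ ∪ C)) (sym fi≡fj) ⟩
      ρ (⁅ f i ⁆ ∪ ⁅ f i ⁆ ∪ C)   ≡⟨ cong ρ (sym (∪-assoc ⁅ f i ⁆ ⁅ f i ⁆ C)) ⟩
      ρ ((⁅ f i ⁆ ∪ ⁅ f i ⁆) ∪ C) ≡⟨ cong (λ Y → ρ (Y ∪ C)) (∪-idem ⁅ f i ⁆) ⟩
      ρ (⁅ f i ⁆ ∪ C)             ≡⟨ point i ⟩
      suc (ρ C)                   ∎

  avoids : ∀ i → f i ∉ C
  avoids i fi∈C = ℕ.1+n≢n (trans (sym (point i))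
    (cong ρ (⊆-antisym (∪-⊆ (x∈p⇒⁅x⁆⊆p fi∈C) (λ e∈ → e∈)) (λ e∈ → x∈p∪q⁺ (inj₂ e∈)))))

  contracted : ∀ X → ρ (image f X ∪ C) ∸ ρ C ≡ uniformRank 2 k X
  contracted X with subset-trichotomy X
  ... | inj₁ refl = begin
    ρ (image f ⊥ ∪ C) ∸ ρ C ≡⟨ cong (λ Y → ρ (Y ∪ C) ∸ ρ C) (image-⊥ f) ⟩
    ρ (⊥ ∪ C) ∸ ρ C         ≡⟨ cong (λ Y → ρ Y ∸ ρ C) (∪-identityˡ C) ⟩
    ρ C ∸ ρ C               ≡⟨ ℕ.n∸n≡0 (ρ C) ⟩
    0                       ≡⟨ cong (_⊓ 2) (sym (∣⊥∣≡0 k)) ⟩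
    ∣ ⊥ {n = k} ∣ ⊓ 2       ∎
  ... | inj₂ (inj₁ (i , refl)) = begin
    ρ (image f ⁅ i ⁆ ∪ C) ∸ ρ C ≡⟨ cong (λ Y → ρ (Y ∪ C) ∸ ρ C) (image-⁅⁆ f i) ⟩
    ρ (⁅ f i ⁆ ∪ C) ∸ ρ C       ≡⟨ cong (_∸ ρ C) (point i) ⟩
    1 + ρ C ∸ ρ C               ≡⟨ ℕ.m+n∸n≡m 1 (ρ C) ⟩
    1                           ≡⟨ cong (_⊓ 2) (sym (∣⁅x⁆∣≡1 i)) ⟩
    ∣ ⁅ i ⁆ ∣ ⊓ 2               ∎
  ... | inj₂ (inj₂ (i , j , i≢j , i∈X , j∈X)) = begin
    ρ (image f X ∪ C) ∸ ρ C ≡⟨ cong (_∸ ρ C) (ℕ.≤-antisym upper lower) ⟩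
    2 + ρ C ∸ ρ C           ≡⟨ ℕ.m+n∸n≡m 2 (ρ C) ⟩
    2                       ≡⟨ sym (ℕ.m≥n⇒m⊓n≡n 2≤∣X∣) ⟩
    ∣ X ∣ ⊓ 2               ∎
    where
    upper : ρ (image f X ∪ C) ≤ 2 + ρ C
    upper = ℕ.≤-trans (rank-mono M _ _ (∪-⊆ (image-⊆ f {X} f∈S) C⊆S)) rankS
    fi∈ : f i ∈ image f X ∪ C
    fi∈ = x∈p∪q⁺ (inj₁ (∈-image⁺ f i∈X))
    fj∈ : f j ∈ image f X ∪ C
    fj∈ = x∈p∪q⁺ (inj₁ (∈-image⁺ f j∈X))
    lower : 2 + ρ C ≤ ρ (image f X ∪ C)
    lower = ℕ.≤-trans (line i j i≢j)
      (rank-mono M _ _ (∪-⊆ (x∈p⇒⁅x⁆⊆p fi∈) (∪-⊆ (x∈p⇒⁅x⁆⊆p fj∈) (λ e∈ → x∈p∪q⁺ (inj₂ e∈)))))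
    2≤∣X∣ : 2 ≤ ∣ X ∣
    2≤∣X∣ = subst (_≤ ∣ X ∣) (∣⁅x⁆∪⁅y⁆∣≡2 i≢j) (p⊆q⇒∣p∣≤∣q∣ (pair-⊆ i∈X j∈X))

module _ {n : ℕ} (M : Matroid n) (simple : Simple M) where

  rank-⁅⁆ : (a : Fin n) → rank M ⁅ a ⁆ ≡ 1
  rank-⁅⁆ a = trans (simple ⁅ a ⁆ (subst (_≤ 2) (sym (∣⁅x⁆∣≡1 a)) (s≤s z≤n))) (∣⁅x⁆∣≡1 a)

  rank-pair : {a b : Fin n} → a ≢ b → rank M (⁅ a ⁆ ∪ ⁅ b ⁆) ≡ 2
  rank-pair a≢b = trans (simple _ (ℕ.≤-reflexive (∣⁅x⁆∪⁅y⁆∣≡2 a≢b))) (∣⁅x⁆∪⁅y⁆∣≡2 a≢b)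

  2≤rank : {a b : Fin n} {X : Subset n} → a ≢ b → a ∈ X → b ∈ X → 2 ≤ rank M X
  2≤rank a≢b a∈X b∈X = subst (_≤ rank M _) (rank-pair a≢b) (rank-mono M _ _ (pair-⊆ a∈X b∈X))

  line-closed : {L S : Subset n} {a b : Fin n} → Line M L → a ∈ L → b ∈ L → a ≢ b →
    a ∈ S → b ∈ S → rank M S ≤ 2 → S ⊆ L
  line-closed {L} {S} (flat , rankL≡2) a∈L b∈L a≢b a∈S b∈S rankS≤2 {e} e∈S with e ∈? L
  ... | yes e∈L = e∈L
  ... | no  e∉L = contradiction submodular (ℕ.<⇒≱ (s≤s (s≤s (s≤s (s≤s (s≤s z≤n))))))
    where
    3≤rank[S∪L] : 3 ≤ rank M (S ∪ L)
    3≤rank[S∪L] = ℕ.≤-trans (subst (_< rank M (⁅ e ⁆ ∪ L)) rankL≡2 (flat e e∉L))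
      (rank-mono M _ _ (∪-⊆ (x∈p⇒⁅x⁆⊆p (x∈p∪q⁺ (inj₁ e∈S))) (λ x∈L → x∈p∪q⁺ (inj₂ x∈L))))
    submodular : 3 + 2 ≤ 2 + 2
    submodular = ℕ.≤-trans (ℕ.+-mono-≤ 3≤rank[S∪L] (2≤rank a≢b (x∈p∩q⁺ (a∈S , a∈L)) (x∈p∩q⁺ (b∈S , b∈L))))
      (ℕ.≤-trans (rank-submod M S L) (ℕ.+-mono-≤ rankS≤2 (ℕ.≤-reflexive rankL≡2)))

  lines-meet : {L L′ : Subset n} {x y : Fin n} → Line M L → Line M L′ → L ≢ L′ →
    x ∈ L → x ∈ L′ → y ∈ L → y ∈ L′ → y ≡ x
  lines-meet {x = x} {y} ℓ ℓ′ L≢L′ x∈L x∈L′ y∈L y∈L′ with y ≟ x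
  ... | yes y≡x = y≡x
  ... | no  y≢x = contradiction
    (⊆-antisym (line-closed ℓ′ x∈L′ y∈L′ (≢-sym y≢x) x∈L y∈L (ℕ.≤-reflexive (proj₂ ℓ)))
               (line-closed ℓ x∈L y∈L (≢-sym y≢x) x∈L′ y∈L′ (ℕ.≤-reflexive (proj₂ ℓ′))))
    L≢L′

  ∉-other-line : {A B : Subset n} {x u : Fin n} → Line M A → Line M B → A ≢ B →
    x ∈ A → x ∈ B → u ∈ A → u ≢ x → u ∉ B
  ∉-other-line ℓA ℓB A≢B x∈A x∈B u∈A u≢x u∈B = u≢x (lines-meet ℓA ℓB A≢B x∈A x∈B u∈A u∈B)

  rank≤2⇒U₂-minor : ∀ {k} {L : Subset n} {vs : Vec (Fin n) k} → rank M L ≤ 2 →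
    Unique vs → All (_∈ L) vs → HasMinor M (uniformRank 2 k)
  rank≤2⇒U₂-minor {L = L} {vs} rankL≤2 unique vs⊆L =
    U₂-minor M ⊥ L (lookup vs) point line (lookup⁺ vs⊆L) ⊥⊆ bound
    where
    point : ∀ i → rank M (⁅ lookup vs i ⁆ ∪ ⊥) ≡ suc (rank M ⊥)
    point i rewrite rank-⊥ M | ∪-identityʳ ⁅ lookup vs i ⁆ = rank-⁅⁆ (lookup vs i)
    line : ∀ i j → i ≢ j → 2 + rank M ⊥ ≤ rank M (⁅ lookup vs i ⁆ ∪ ⁅ lookup vs j ⁆ ∪ ⊥)
    line i j i≢j rewrite rank-⊥ M = 2≤rank (λ eq → i≢j (lookup-injective unique i j eq))
      (x∈p∪q⁺ (inj₁ (x∈⁅x⁆ _))) (x∈p∪q⁺ (inj₂ (x∈p∪q⁺ (inj₁ (x∈⁅x⁆ _)))))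
    bound : rank M L ≤ 2 + rank M ⊥
    bound rewrite rank-⊥ M = rankL≤2

  noncollinear⇒U₂-minor : ∀ {k} {vs : Vec (Fin n) k} → rank M ⊤ ≡ 3 → (p : Fin n) →
    Unique vs → p ∉ fromVec vs → (∀ {a b} → a ∈ᵥ vs → b ∈ᵥ vs → a ≢ b → ¬ Collinear M p a b) →
    HasMinor M (uniformRank 2 k)
  noncollinear⇒U₂-minor {vs = vs} rank⊤≡3 p unique p∉vs noncollinear =
    U₂-minor M ⁅ p ⁆ ⊤ (lookup vs) point line (λ _ → ∈⊤) (λ _ → ∈⊤) bound
    where
    point : ∀ i → rank M (⁅ lookup vs i ⁆ ∪ ⁅ p ⁆) ≡ suc (rank M ⁅ p ⁆)
    point i rewrite rank-⁅⁆ p = rank-pair (≢-sym (lookup⁺ (∉fromVec⇒All≢ vs p∉vs) i))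
    line : ∀ i j → i ≢ j → 2 + rank M ⁅ p ⁆ ≤ rank M (⁅ lookup vs i ⁆ ∪ ⁅ lookup vs j ⁆ ∪ ⁅ p ⁆)
    line i j i≢j rewrite rank-⁅⁆ p = ℕ.≤-trans
      (ℕ.≰⇒> (noncollinear (∈-lookup i vs) (∈-lookup j vs) (λ eq → i≢j (lookup-injective unique i j eq))))
      (rank-mono M _ _ (fromVec-⊆ (x∈p∪q⁺ (inj₂ (x∈p∪q⁺ (inj₂ (x∈⁅x⁆ p))))
                                  ∷ x∈p∪q⁺ (inj₁ (x∈⁅x⁆ (lookup vs i)))
                                  ∷ x∈p∪q⁺ (inj₂ (x∈p∪q⁺ (inj₁ (x∈⁅x⁆ (lookup vs j))))) ∷ [])))
    bound : rank M ⊤ ≤ 2 + rank M ⁅ p ⁆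
    bound rewrite rank-⁅⁆ p | rank⊤≡3 = ℕ.≤-refl

  two-points-besides : {L : Subset n} {x : Fin n} → LongLine M L → x ∈ L →
    ∃₂ λ u v → Unique (u ∷ v ∷ x ∷ []) × All (_∈ L) (u ∷ v ∷ x ∷ [])
  two-points-besides {L} {x} (_ , a , b , c , a∈L , b∈L , c∈L , _ , _ , _ , r[ab] , r[ac] , r[bc]) x∈L =
    choose (rank-pair≡2⇒≢ M r[ab]) (rank-pair≡2⇒≢ M r[ac]) (rank-pair≡2⇒≢ M r[bc])
    where
    choose : a ≢ b → a ≢ c → b ≢ c → ∃₂ λ u v → Unique (u ∷ v ∷ x ∷ []) × All (_∈ L) (u ∷ v ∷ x ∷ [])
    choose a≢b a≢c b≢c with a ≟ x | b ≟ x
    ... | yes refl | _        = b , c , (b≢c ∷ ≢-sym a≢b ∷ []) ∷ (≢-sym a≢c ∷ []) ∷ [] ∷ [] , b∈L ∷ c∈L ∷ x∈L ∷ []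
    ... | no a≢x   | yes refl = a , c , (a≢c ∷ a≢x ∷ []) ∷ (≢-sym b≢c ∷ []) ∷ [] ∷ [] , a∈L ∷ c∈L ∷ x∈L ∷ []
    ... | no a≢x   | no b≢x   = a , b , (a≢b ∷ a≢x ∷ []) ∷ (b≢x ∷ []) ∷ [] ∷ [] , a∈L ∷ b∈L ∷ x∈L ∷ []

  minor⊎three-or-four-points : {L : Subset n} {x : Fin n} → LongLine M L → x ∈ L →
    HasU25Minor M ⊎ ThreeOrFourPoints L x
  minor⊎three-or-four-points {L} ℓ x∈L with two-points-besides ℓ x∈L
  ... | _ , _ , unique , on-L with ≡fromVec⊎extend L unique on-L
  ...   | inj₁ L≡ = inj₂ (three unique L≡)
  ...   | inj₂ (_ , unique′ , on-L′) with ≡fromVec⊎extend L unique′ on-L′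
  ...     | inj₁ L≡ = inj₂ (four unique′ L≡)
  ...     | inj₂ (_ , unique″ , on-L″) = inj₁ (rank≤2⇒U₂-minor (ℕ.≤-reflexive (proj₂ (proj₁ ℓ))) unique″ on-L″)

  concurrent-count : {L₁ L₂ L₃ : Subset n} {x : Fin n} → Concurrent M L₁ L₂ L₃ x →
    ∣ L₁ ∣ + ∣ L₂ ∣ + ∣ L₃ ∣ ≡ n + 2
  concurrent-count {L₁} {L₂} {L₃} {x} conc = begin
    ∣ L₁ ∣ + ∣ L₂ ∣ + ∣ L₃ ∣            ≡⟨ cong (_+ ∣ L₃ ∣) (sym (∣p∪q∣+1≡∣p∣+∣q∣ L₁∩L₂≡x)) ⟩
    ∣ L₁ ∪ L₂ ∣ + 1 + ∣ L₃ ∣            ≡⟨ ℕ.+-assoc (∣ L₁ ∪ L₂ ∣) 1 (∣ L₃ ∣) ⟩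
    ∣ L₁ ∪ L₂ ∣ + (1 + ∣ L₃ ∣)          ≡⟨ cong (∣ L₁ ∪ L₂ ∣ +_) (ℕ.+-comm 1 (∣ L₃ ∣)) ⟩
    ∣ L₁ ∪ L₂ ∣ + (∣ L₃ ∣ + 1)          ≡⟨ sym (ℕ.+-assoc (∣ L₁ ∪ L₂ ∣) (∣ L₃ ∣) 1) ⟩
    ∣ L₁ ∪ L₂ ∣ + ∣ L₃ ∣ + 1            ≡⟨ cong (_+ 1) (sym (∣p∪q∣+1≡∣p∣+∣q∣ [L₁∪L₂]∩L₃≡x)) ⟩
    ∣ (L₁ ∪ L₂) ∪ L₃ ∣ + 1 + 1          ≡⟨ cong (λ X → ∣ X ∣ + 1 + 1) covers ⟩
    ∣ ⊤ {n} ∣ + 1 + 1                   ≡⟨ cong (λ m → m + 1 + 1) (∣⊤∣≡n n) ⟩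
    n + 1 + 1                           ≡⟨ ℕ.+-assoc n 1 1 ⟩
    n + 2                               ∎
    where
    open Concurrent conc
    meet : {A B : Subset n} {e : Fin n} → Line M A → Line M B → A ≢ B → x ∈ A → x ∈ B →
           e ∈ A → e ∈ B → e ∈ ⁅ x ⁆
    meet ℓA ℓB A≢B x∈A x∈B e∈A e∈B = subst (_∈ ⁅ x ⁆) (sym (lines-meet ℓA ℓB A≢B x∈A x∈B e∈A e∈B)) (x∈⁅x⁆ x)
    L₁∩L₂≡x : L₁ ∩ L₂ ≡ ⁅ x ⁆
    L₁∩L₂≡x = ⊆-antisym
      (λ e∈ → let e∈L₁ , e∈L₂ = x∈p∩q⁻ L₁ L₂ e∈ in meet (proj₁ long₁) (proj₁ long₂) L₁≢L₂ x∈L₁ x∈L₂ e∈L₁ e∈L₂)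
      (x∈p⇒⁅x⁆⊆p (x∈p∩q⁺ (x∈L₁ , x∈L₂)))
    [L₁∪L₂]∩L₃≡x : (L₁ ∪ L₂) ∩ L₃ ≡ ⁅ x ⁆
    [L₁∪L₂]∩L₃≡x = ⊆-antisym
      (λ e∈ → let e∈L₁∪L₂ , e∈L₃ = x∈p∩q⁻ (L₁ ∪ L₂) L₃ e∈ in
        [ (λ e∈L₁ → meet (proj₁ long₁) (proj₁ long₃) L₁≢L₃ x∈L₁ x∈L₃ e∈L₁ e∈L₃)
        , (λ e∈L₂ → meet (proj₁ long₂) (proj₁ long₃) L₂≢L₃ x∈L₂ x∈L₃ e∈L₂ e∈L₃) ] (x∈p∪q⁻ L₁ L₂ e∈L₁∪L₂))
      (x∈p⇒⁅x⁆⊆p (x∈p∩q⁺ (x∈p∪q⁺ (inj₁ x∈L₁) , x∈L₃)))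
    covers : (L₁ ∪ L₂) ∪ L₃ ≡ ⊤
    covers = ⊆-antisym (λ _ → ∈⊤) λ {e} _ →
      [ (λ e∈L₁ → x∈p∪q⁺ (inj₁ (x∈p∪q⁺ (inj₁ e∈L₁))))
      , [ (λ e∈L₂ → x∈p∪q⁺ (inj₁ (x∈p∪q⁺ (inj₂ e∈L₂)))) , (λ e∈L₃ → x∈p∪q⁺ (inj₂ e∈L₃)) ] ] (cover e)

  module ReidGeometry (rank⊤≡3 : rank M ⊤ ≡ 3) {L₁ L₂ L₃ : Subset n} {x : Fin n}
                      (conc : Concurrent M L₁ L₂ L₃ x) where

    open Concurrent conc

    off₁₂ : {u : Fin n} → u ∈ L₁ → u ≢ x → u ∉ L₂
    off₁₂ = ∉-other-line (proj₁ long₁) (proj₁ long₂) L₁≢L₂ x∈L₁ x∈L₂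
    off₁₃ : {u : Fin n} → u ∈ L₁ → u ≢ x → u ∉ L₃
    off₁₃ = ∉-other-line (proj₁ long₁) (proj₁ long₃) L₁≢L₃ x∈L₁ x∈L₃
    off₂₁ : {u : Fin n} → u ∈ L₂ → u ≢ x → u ∉ L₁
    off₂₁ = ∉-other-line (proj₁ long₂) (proj₁ long₁) (≢-sym L₁≢L₂) x∈L₂ x∈L₁
    off₂₃ : {u : Fin n} → u ∈ L₂ → u ≢ x → u ∉ L₃
    off₂₃ = ∉-other-line (proj₁ long₂) (proj₁ long₃) L₂≢L₃ x∈L₂ x∈L₃
    off₃₁ : {u : Fin n} → u ∈ L₃ → u ≢ x → u ∉ L₁
    off₃₁ = ∉-other-line (proj₁ long₃) (proj₁ long₁) (≢-sym L₁≢L₃) x∈L₃ x∈L₁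
    off₃₂ : {u : Fin n} → u ∈ L₃ → u ≢ x → u ∉ L₂
    off₃₂ = ∉-other-line (proj₁ long₃) (proj₁ long₂) (≢-sym L₂≢L₃) x∈L₃ x∈L₂

    Partner : Fin n → Fin n → Set
    Partner c b = ∃ λ a → a ∈ L₁ × a ≢ x × Collinear M c a b

    partner? : ∀ c b → Dec (Partner c b)
    partner? c b = any? λ a → (a ∈? L₁) ×-dec ¬? (a ≟ x) ×-dec (rank M (fromVec (c ∷ a ∷ b ∷ [])) ℕ.≤? 2)

    no-partner⇒minor : {c b : Fin n} {as : Vec (Fin n) 4} → Unique as → L₁ ≡ fromVec as →
      c ∈ L₃ → c ≢ x → b ∈ L₂ → b ≢ x → ¬ Partner c b → HasU25Minor M
    no-partner⇒minor {c} {b} {as} unique L₁≡as c∈L₃ c≢x b∈L₂ b≢x no-partner =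
      noncollinear⇒U₂-minor rank⊤≡3 c (∉fromVec⇒All≢ as (subst (b ∉_) L₁≡as (off₂₁ b∈L₂ b≢x)) ∷ unique) c∉ noncollinear
      where
      on-L₁ : {a : Fin n} → a ∈ᵥ as → a ∈ L₁
      on-L₁ a∈as = subst (_ ∈_) (sym L₁≡as) (∈-fromVec⁺ a∈as)
      c∉ : c ∉ fromVec (b ∷ as)
      c∉ c∈ = [ (λ c∈b → off₃₂ c∈L₃ c≢x (subst (_∈ L₂) (sym (x∈⁅y⁆⇒x≡y b c∈b)) b∈L₂))
              , (λ c∈as → off₃₁ c∈L₃ c≢x (on-L₁ (∈-fromVec⁻ as c∈as))) ] (x∈p∪q⁻ ⁅ b ⁆ (fromVec as) c∈)
      ¬collinear-with-b : {a : Fin n} → a ∈ L₁ → ¬ Collinear M c a b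
      ¬collinear-with-b {a} a∈L₁ col with a ≟ x
      ... | no a≢x  = no-partner (a , a∈L₁ , a≢x , col)
      ... | yes refl = let c∈T , x∈T , b∈T = ∈-triangle c a b in
        off₂₃ b∈L₂ b≢x (line-closed (proj₁ long₃) c∈L₃ x∈L₃ c≢x c∈T x∈T col b∈T)
      noncollinear : {a a′ : Fin n} → a ∈ᵥ b ∷ as → a′ ∈ᵥ b ∷ as → a ≢ a′ → ¬ Collinear M c a a′
      noncollinear (here refl) (here refl) b≢b = contradiction refl b≢b
      noncollinear (here refl) (there a′∈as) _ col = ¬collinear-with-b (on-L₁ a′∈as) (Collinear-swap M col)
      noncollinear (there a∈as) (here refl) _ col = ¬collinear-with-b (on-L₁ a∈as) col
      noncollinear {a} {a′} (there a∈as) (there a′∈as) a≢a′ col = let c∈T , a∈T , a′∈T = ∈-triangle c a a′ in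
        off₃₁ c∈L₃ c≢x (line-closed (proj₁ long₁) (on-L₁ a∈as) (on-L₁ a′∈as) a≢a′ a∈T a′∈T col c∈T)

    triangle-line : {c a b : Fin n} → c ∈ L₃ → c ≢ x → a ∈ L₁ → a ≢ x → b ∈ L₂ → b ≢ x →
      Collinear M c a b → LongLine M (fromVec (c ∷ a ∷ b ∷ []))
    triangle-line {c} {a} {b} c∈L₃ c≢x a∈L₁ a≢x b∈L₂ b≢x col =
      (flat , rank≡2) , c , a , b , c∈T , a∈T , b∈T ,
      rank-⁅⁆ c , rank-⁅⁆ a , rank-⁅⁆ b , rank-pair c≢a , rank-pair c≢b , rank-pair a≢b
      where
      T : Subset n
      T = fromVec (c ∷ a ∷ b ∷ [])
      c∈T : c ∈ T
      c∈T = proj₁ (∈-triangle c a b)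
      a∈T : a ∈ T
      a∈T = proj₁ (proj₂ (∈-triangle c a b))
      b∈T : b ∈ T
      b∈T = proj₂ (proj₂ (∈-triangle c a b))
      c≢a : c ≢ a
      c≢a refl = off₃₁ c∈L₃ c≢x a∈L₁
      c≢b : c ≢ b
      c≢b refl = off₃₂ c∈L₃ c≢x b∈L₂
      a≢b : a ≢ b
      a≢b refl = off₁₂ a∈L₁ a≢x b∈L₂
      rank≡2 : rank M T ≡ 2
      rank≡2 = ℕ.≤-antisym col (2≤rank c≢a c∈T a∈T)
      -- If e raised no rank, the line Lᵢ through e given by the cover would contain a
      -- second point of T, hence all of T, but each Lᵢ misses one of c, a, b.
      flat : Flat M T
      flat e e∉T with rank M (⁅ e ⁆ ∪ T) ℕ.≤? 2
      ... | no  rank≰2 = subst (_< rank M (⁅ e ⁆ ∪ T)) (sym rank≡2) (ℕ.≰⇒> rank≰2)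
      ... | yes rank≤2 = ⊥-elim ([ on-L₁ , [ on-L₂ , on-L₃ ] ] (cover e))
        where
        in-S : ∀ {v} → v ∈ T → v ∈ ⁅ e ⁆ ∪ T
        in-S v∈T = x∈p∪q⁺ (inj₂ v∈T)
        e∈S : e ∈ ⁅ e ⁆ ∪ T
        e∈S = x∈p∪q⁺ (inj₁ (x∈⁅x⁆ e))
        ≢e : ∀ {v} → v ∈ T → v ≢ e
        ≢e v∈T refl = e∉T v∈T
        on-L₁ : e ∈ L₁ → Empty
        on-L₁ e∈L₁ = off₃₁ c∈L₃ c≢x (line-closed (proj₁ long₁) a∈L₁ e∈L₁ (≢e a∈T) (in-S a∈T) e∈S rank≤2 (in-S c∈T))
        on-L₂ : e ∈ L₂ → Empty
        on-L₂ e∈L₂ = off₃₂ c∈L₃ c≢x (line-closed (proj₁ long₂) b∈L₂ e∈L₂ (≢e b∈T) (in-S b∈T) e∈S rank≤2 (in-S c∈T))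
        on-L₃ : e ∈ L₃ → Empty
        on-L₃ e∈L₃ = off₁₃ a∈L₁ a≢x (line-closed (proj₁ long₃) c∈L₃ e∈L₃ (≢e c∈T) (in-S c∈T) e∈S rank≤2 (in-S a∈T))

    L₃≢triangle : {c a b : Fin n} → b ∈ L₂ → b ≢ x → L₃ ≢ fromVec (c ∷ a ∷ b ∷ [])
    L₃≢triangle {c} {a} {b} b∈L₂ b≢x L₃≡T =
      off₂₃ b∈L₂ b≢x (subst (b ∈_) (sym L₃≡T) (proj₂ (proj₂ (∈-triangle c a b))))

    triangle≢triangle : {c a b a′ b′ : Fin n} → c ∈ L₃ → c ≢ x → b ∈ L₂ → b ≢ x → a′ ∈ L₁ → b ≢ b′ →
      fromVec (c ∷ a ∷ b ∷ []) ≢ fromVec (c ∷ a′ ∷ b′ ∷ [])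
    triangle≢triangle {c} {a} {b} {a′} {b′} c∈L₃ c≢x b∈L₂ b≢x a′∈L₁ b≢b′ T≡T′
      with ∈-fromVec⁻ (c ∷ a′ ∷ b′ ∷ []) (subst (b ∈_) T≡T′ (proj₂ (proj₂ (∈-triangle c a b))))
    ... | here refl                 = off₃₂ c∈L₃ c≢x b∈L₂
    ... | there (here refl)         = off₂₁ b∈L₂ b≢x a′∈L₁
    ... | there (there (here b≡b′)) = b≢b′ b≡b′

    partners⇒OnFourLongLines : {c b₁ b₂ b₃ : Fin n} → c ∈ L₃ → c ≢ x →
      Unique (b₁ ∷ b₂ ∷ b₃ ∷ x ∷ []) → All (_∈ L₂) (b₁ ∷ b₂ ∷ b₃ ∷ x ∷ []) →
      (∀ b → b ∈ L₂ → b ≢ x → Partner c b) → OnFourLongLines M c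
    partners⇒OnFourLongLines {c} {b₁} {b₂} {b₃} c∈L₃ c≢x
      ((b₁≢b₂ ∷ b₁≢b₃ ∷ b₁≢x ∷ []) ∷ (b₂≢b₃ ∷ b₂≢x ∷ []) ∷ (b₃≢x ∷ []) ∷ [] ∷ [])
      (b₁∈L₂ ∷ b₂∈L₂ ∷ b₃∈L₂ ∷ _) partner =
      let a₁ , a₁∈L₁ , a₁≢x , col₁ = partner b₁ b₁∈L₂ b₁≢x
          a₂ , a₂∈L₁ , a₂≢x , col₂ = partner b₂ b₂∈L₂ b₂≢x
          a₃ , a₃∈L₁ , a₃≢x , col₃ = partner b₃ b₃∈L₂ b₃≢x
      in L₃ , fromVec (c ∷ a₁ ∷ b₁ ∷ []) , fromVec (c ∷ a₂ ∷ b₂ ∷ []) , fromVec (c ∷ a₃ ∷ b₃ ∷ []) ,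
         long₃ , triangle-line c∈L₃ c≢x a₁∈L₁ a₁≢x b₁∈L₂ b₁≢x col₁ ,
                 triangle-line c∈L₃ c≢x a₂∈L₁ a₂≢x b₂∈L₂ b₂≢x col₂ ,
                 triangle-line c∈L₃ c≢x a₃∈L₁ a₃≢x b₃∈L₂ b₃≢x col₃ ,
         c∈L₃ , proj₁ (∈-triangle c a₁ b₁) , proj₁ (∈-triangle c a₂ b₂) , proj₁ (∈-triangle c a₃ b₃) ,
         L₃≢triangle b₁∈L₂ b₁≢x , L₃≢triangle b₂∈L₂ b₂≢x , L₃≢triangle b₃∈L₂ b₃≢x ,
         triangle≢triangle c∈L₃ c≢x b₁∈L₂ b₁≢x a₂∈L₁ b₁≢b₂ ,
         triangle≢triangle c∈L₃ c≢x b₁∈L₂ b₁≢x a₃∈L₁ b₁≢b₃ ,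
         triangle≢triangle c∈L₃ c≢x b₂∈L₂ b₂≢x a₃∈L₁ b₂≢b₃

    partner⊎minor : {c : Fin n} {as : Vec (Fin n) 4} → Unique as → L₁ ≡ fromVec as → c ∈ L₃ → c ≢ x →
      ∀ b → HasU25Minor M ⊎ (b ∈ L₂ → b ≢ x → Partner c b)
    partner⊎minor {c} unique L₁≡as c∈L₃ c≢x b with (b ∈? L₂) ×-dec ¬? (b ≟ x)
    ... | no ¬on-L₂∖x = inj₂ λ b∈L₂ b≢x → contradiction (b∈L₂ , b≢x) ¬on-L₂∖x
    ... | yes (b∈L₂ , b≢x) with partner? c b
    ...   | yes partner    = inj₂ λ _ _ → partner
    ...   | no  no-partner = inj₁ (no-partner⇒minor unique L₁≡as c∈L₃ c≢x b∈L₂ b≢x no-partner)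

    OnFourLongLines⊎minor : {as : Vec (Fin n) 4} {b₁ b₂ b₃ : Fin n} →
      Unique as → L₁ ≡ fromVec as → Unique (b₁ ∷ b₂ ∷ b₃ ∷ x ∷ []) → L₂ ≡ fromVec (b₁ ∷ b₂ ∷ b₃ ∷ x ∷ []) →
      ∀ c → HasU25Minor M ⊎ (c ∈ L₃ → c ≢ x → OnFourLongLines M c)
    OnFourLongLines⊎minor unique₁ L₁≡as unique₂ L₂≡bs c with (c ∈? L₃) ×-dec ¬? (c ≟ x)
    ... | no ¬on-L₃∖x = inj₂ λ c∈L₃ c≢x → contradiction (c∈L₃ , c≢x) ¬on-L₃∖x
    ... | yes (c∈L₃ , c≢x) = map₂ (λ partner _ _ → partners⇒OnFourLongLines c∈L₃ c≢x unique₂ (≡fromVec⇒All∈ L₂≡bs) partner)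
                                  (∀⊎⇒⊎∀ (partner⊎minor unique₁ L₁≡as c∈L₃ c≢x))

    minor⊎R₉ : {as : Vec (Fin n) 4} {b₁ b₂ b₃ : Fin n} →
      Unique as → L₁ ≡ fromVec as → Unique (b₁ ∷ b₂ ∷ b₃ ∷ x ∷ []) → L₂ ≡ fromVec (b₁ ∷ b₂ ∷ b₃ ∷ x ∷ []) →
      ∣ L₃ ∣ ≡ 3 → HasU25Minor M ⊎ IsR₉ M
    minor⊎R₉ unique₁ L₁≡as unique₂ L₂≡bs ∣L₃∣≡3 =
      map₂ (λ on-four → simple , rank⊤≡3 , L₁ , L₂ , L₃ , x , long₁ , long₂ , long₃ , L₁≢L₂ , L₁≢L₃ , L₂≢L₃ ,
                        x∈L₁ , x∈L₂ , x∈L₃ , cover ,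
                        trans (cong ∣_∣ L₁≡as) (∣fromVec∣ unique₁) , trans (cong ∣_∣ L₂≡bs) (∣fromVec∣ unique₂) ,
                        ∣L₃∣≡3 , on-four)
           (∀⊎⇒⊎∀ (OnFourLongLines⊎minor unique₁ L₁≡as unique₂ L₂≡bs))

minor⊎R₉-by-count : (M : Matroid 9) → Simple M → rank M ⊤ ≡ 3 →
  {L₁ L₂ L₃ : Subset 9} {x : Fin 9} → Concurrent M L₁ L₂ L₃ x →
  (s₁ : ThreeOrFourPoints L₁ x) (s₂ : ThreeOrFourPoints L₂ x) (s₃ : ThreeOrFourPoints L₃ x) →
  pointCount s₁ + pointCount s₂ + pointCount s₃ ≡ 11 → HasU25Minor M ⊎ IsR₉ M
minor⊎R₉-by-count M simple rank⊤≡3 conc (four u₁ L₁≡) (four u₂ L₂≡) s₃@(three _ _) _ =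
  ReidGeometry.minor⊎R₉ M simple rank⊤≡3 conc u₁ L₁≡ u₂ L₂≡ (∣L∣≡pointCount s₃)
minor⊎R₉-by-count M simple rank⊤≡3 conc s₁@(three _ _) (four u₂ L₂≡) (four u₃ L₃≡) _ =
  ReidGeometry.minor⊎R₉ M simple rank⊤≡3 (Concurrent-rotate M conc) u₂ L₂≡ u₃ L₃≡ (∣L∣≡pointCount s₁)
minor⊎R₉-by-count M simple rank⊤≡3 conc (four u₁ L₁≡) s₂@(three _ _) (four u₃ L₃≡) _ =
  ReidGeometry.minor⊎R₉ M simple rank⊤≡3 (Concurrent-swap M conc) u₁ L₁≡ u₃ L₃≡ (∣L∣≡pointCount s₂)
minor⊎R₉-by-count _ _ _ _ (three _ _) (three _ _) (three _ _) ()
minor⊎R₉-by-count _ _ _ _ (three _ _) (three _ _) (four _ _)  ()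
minor⊎R₉-by-count _ _ _ _ (three _ _) (four _ _)  (three _ _) ()
minor⊎R₉-by-count _ _ _ _ (four _ _)  (three _ _) (three _ _) ()
minor⊎R₉-by-count _ _ _ _ (four _ _)  (four _ _)  (four _ _)  ()

lemma5p1 : (M : Matroid 9) → Simple M → rank M ⊤ ≡ 3
    → UnionOfThreeConcurrentLongLines M
    → HasU25Minor M ⊎ IsR₉ M
lemma5p1 M simple rank⊤≡3 (L₁ , L₂ , L₃ , x , ℓ₁ , ℓ₂ , ℓ₃ , L₁≢L₂ , L₁≢L₃ , L₂≢L₃ , x∈L₁ , x∈L₂ , x∈L₃ , cover)
  with minor⊎three-or-four-points M simple ℓ₁ x∈L₁
     | minor⊎three-or-four-points M simple ℓ₂ x∈L₂
     | minor⊎three-or-four-points M simple ℓ₃ x∈L₃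
... | inj₁ minor | _          | _          = inj₁ minor
... | inj₂ _     | inj₁ minor | _          = inj₁ minor
... | inj₂ _     | inj₂ _     | inj₁ minor = inj₁ minor
... | inj₂ s₁    | inj₂ s₂    | inj₂ s₃    = minor⊎R₉-by-count M simple rank⊤≡3 conc s₁ s₂ s₃
  (trans (sym (cong₂ _+_ (cong₂ _+_ (∣L∣≡pointCount s₁) (∣L∣≡pointCount s₂)) (∣L∣≡pointCount s₃)))
         (concurrent-count M simple conc))
  where
  conc : Concurrent M L₁ L₂ L₃ x
  conc = concurrent ℓ₁ ℓ₂ ℓ₃ L₁≢L₂ L₁≢L₃ L₂≢L₃ x∈L₁ x∈L₂ x∈L₃ cover
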